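{- Let $n\ge1$ and let $t$ be a rational number such that the complete graph $K_n$ has at least one threshold assignment with average threshold $t$. Then $Dyn_{\bar t=t}(K_n)=\lfloor t\rfloor$.
   Context: Graphs are finite, undirected, simple. A threshold assignment for $G$ is a function $\tau:V(G)\to\mathbb{N}\cup\{0\}$ with $\tau(v)\le \deg(v)$ for every $v$; its average threshold is $\sum_v\tau(v)/|G|$. For $M\subseteq V(G)$, the $\tau$-dynamic process starting from $M$ is $D_0=M$ and, for $i\ge0$, $D_{i+1}$ = set of vertices $v\notin D_0\cup\dots\cup D_i$ with at least $\tau(v)$ neighbours in $D_0\cup\dots\cup D_i$; $M$ is a $\tau$-dynamic monopoly if $\bigcup_i D_i=V(G)$. $dyn_\tau(G)$ is the minimum size of a $\tau$-dynamic monopoly, and $Dyn_{\bar t=t}(G)$ is the maximum of $dyn_\tau(G)$ over threshold assignments with average threshold $t$. -}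

module Defs where

open import Data.Nat using (ℕ; zero; suc; _+_; _≤_; _≤?_)
open import Data.Bool using (Bool; true; false; _∨_; not)
open import Data.Fin using (Fin; zero; suc; _≟_)
open import Data.Fin.Subset using (Subset; _∩_; ⊤; ∣_∣; _∈_)
open import Data.Vec using (tabulate; lookup)
open import Data.Product using (Σ; ∃; ∃-syntax; _×_; _,_)
open import Data.Integer using (ℤ; +_)
open import Data.Rational using (ℚ; _/_)
open import Relation.Nullary.Decidable using (⌊_⌋)
open import Relation.Binary.PropositionalEquality using (_≡_; refl)
import Relation.Binary.PropositionalEquality as Eq
open import Relation.Nullary using (yes; no)
open import Data.Empty using (⊥-elim)

record Graph (n : ℕ) : Set where
  field
    adj    : Fin n → Fin n → Bool
    sym    : ∀ u v → adj u v ≡ adj v u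
    irrefl : ∀ v → adj v v ≡ false
open Graph public

private
  neqB : ∀ {n} → Fin n → Fin n → Bool
  neqB u v = not ⌊ u ≟ v ⌋

K-sym : ∀ {n} (u v : Fin n) → neqB u v ≡ neqB v u
K-sym zero zero = refl
K-sym zero (suc v) = refl
K-sym (suc u) zero = refl
K-sym (suc u) (suc v) with u ≟ v | v ≟ u
... | yes _ | yes _ = refl
... | no _ | no _ = refl
... | yes p | no q = ⊥-elim (q (Eq.sym p))
... | no p | yes q = ⊥-elim (p (Eq.sym q))

K-irrefl : ∀ {n} (v : Fin n) → neqB v v ≡ false
K-irrefl zero = refl
K-irrefl (suc v) with v ≟ v
... | yes _ = refl
... | no p = ⊥-elim (p refl)

K : (n : ℕ) → Graph n
K n = record { adj = neqB ; sym = K-sym ; irrefl = K-irrefl }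

module _ {n : ℕ} (G : Graph n) where

  N : Fin n → Subset n
  N v = tabulate (adj G v)

  deg : Fin n → ℕ
  deg v = ∣ N v ∣

  IsThreshold : (Fin n → ℕ) → Set
  IsThreshold τ = ∀ v → τ v ≤ deg v

  -- one step of the process on the cumulative set A = D_0 ∪ ... ∪ D_i:
  -- add all vertices having at least τ(v) neighbours in A
  step : (Fin n → ℕ) → Subset n → Subset n
  step τ A = tabulate (λ v → lookup A v ∨ ⌊ τ v ≤? ∣ A ∩ N v ∣ ⌋)

  active : (Fin n → ℕ) → Subset n → ℕ → Subset n
  active τ M zero = M
  active τ M (suc i) = step τ (active τ M i)

  IsDynMonopoly : (Fin n → ℕ) → Subset n → Set
  IsDynMonopoly τ M = ∃[ i ] (active τ M i ≡ ⊤)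

  IsDyn : (Fin n → ℕ) → ℕ → Set
  IsDyn τ m = (∃[ M ] (IsDynMonopoly τ M × ∣ M ∣ ≡ m))
            × (∀ M → IsDynMonopoly τ M → m ≤ ∣ M ∣)

sumFin : ∀ n → (Fin n → ℕ) → ℕ
sumFin zero f = 0
sumFin (suc n) f = f zero + sumFin n (λ i → f (suc i))

HasAvg : ∀ {k} → Graph (suc k) → (Fin (suc k) → ℕ) → ℚ → Set
HasAvg {k} G τ t = IsThreshold G τ × ((+ sumFin (suc k) τ) / suc k ≡ t)

IsDynAvg : ∀ {k} → Graph (suc k) → ℚ → ℕ → Set
IsDynAvg G t d = (∃[ τ ] (HasAvg G τ t × IsDyn G τ d))
               × (∀ τ m → HasAvg G τ t → IsDyn G τ m → m ≤ d)

-- In K_n a vertex outside the active set A becomes active exactly when its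
-- threshold is at most ∣A∣. Let M be the m vertices of largest threshold. If
-- the process from M stalled at some A ≠ V, every vertex outside A, and hence
-- every vertex of M, would have threshold above ∣A∣, so that
-- ∑τ ≥ (1 + ∣A∣)(n − ∣A∣ + m) ≥ (1 + m)n. Thus M is a dynamic monopoly as soon
-- as ∑τ < (1 + m)n, which gives dyn_τ(K_n) ≤ ⌊∑τ/n⌋ = ⌊t⌋. Conversely, the
-- assignment taking the values ⌊t⌋ and ⌊t⌋ + 1 has average t, and no set of
-- fewer than ⌊t⌋ vertices activates anything under it.

module Submission where

open import Defs hiding (sym)
open import Data.Bool using (true; false; _∨_; if_then_else_)
open import Data.Bool.Properties using (T-≡; T-∨)
open import Data.Fin using (Fin; zero; suc; toℕ; _≟_)
open import Data.Fin.Properties using (any?)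
open import Data.Fin.Subset
  using (Subset; inside; outside; ⊤; ⊥; ⁅_⁆; ∁; _∪_; _∩_; _∈_; _∉_; _⊆_; _⊂_; Nonempty; ∣_∣)
open import Data.Fin.Subset.Properties
  using ( _∈?_; ∈⊤; ⊆⊤; ⊆-antisym; p⊆q⇒∣p∣≤∣q∣; p⊂q⇒∣p∣<∣q∣; ∣p∣≤n; ∣⊤∣≡n; ∣∁p∣≡n∸∣p∣
        ; ∣⁅x⁆∣≡1; x∈⁅y⁆⇒x≡y; x∉⁅y⁆⇒x≢y; x≢y⇒x∉⁅y⁆; x∈∁p⇒x∉p; x∉p⇒x∈∁p
        ; x∈p∪q⁺; x∈p∪q⁻; x∈p∩q⁺; nonempty?; ∉⊥; ∣⊥∣≡0; ∣p∩q∣≤∣p∣)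
open import Data.Integer as ℤ using (-[1+_])
import Data.Integer.Properties as ℤ
open import Data.Integer.DivMod using (div-pos-is-/ℕ)
open import Data.Nat
  using (ℕ; zero; suc; _+_; _*_; _∸_; _/_; _%_; _≤_; _<_; _≤?_; _<ᵇ_; z≤n; s≤s; z<s; NonZero)
open import Data.Nat.DivMod using (m≡m%n+[m/n]*n; m%n<n; m*n/o*n≡m/o; m*n/n≡m; /-monoˡ-≤)
open import Data.Nat.Properties hiding (_≟_)
open import Data.Nat.Tactic.RingSolver using (solve-∀)
open import Algebra.Properties.CommutativeSemigroup +-commutativeSemigroup using (interchange)
open import Data.Product using (∃-syntax; _×_; _,_)
open import Data.Rational using (ℚ; mkℚ; ↥_; ↧_; floor)
import Data.Rational as ℚ
open import Data.Rational.Properties using (↥-/; ↧-/)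
open import Data.Sum as Sum using (_⊎_; inj₁; inj₂)
open import Data.Vec using ([]; _∷_; lookup; here; there)
open import Data.Vec.Properties using (lookup∘tabulate; []=⇒lookup; lookup⇒[]=)
open import Function using (id; _∘_; Equivalence)
open import Relation.Binary.PropositionalEquality
open import Relation.Nullary using (¬_; yes; no; contradiction)
open import Relation.Nullary.Decidable using (isYes; fromWitnessFalse; toWitness; fromWitness; decidable-stable; ¬?; _×-dec_)

open Equivalence

sumFin-const : ∀ n c → sumFin n (λ _ → c) ≡ n * c
sumFin-const zero    c = refl
sumFin-const (suc n) c = cong (c +_) (sumFin-const n c)

sumFin-+ : ∀ n (f g : Fin n → ℕ) → sumFin n (λ v → f v + g v) ≡ sumFin n f + sumFin n g
sumFin-+ zero    f g = refl
sumFin-+ (suc n) f g = trans (cong (f zero + g zero +_) (sumFin-+ n (f ∘ suc) (g ∘ suc)))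
                             (interchange (f zero) (g zero) (sumFin n (f ∘ suc)) (sumFin n (g ∘ suc)))

sumFin-≤ : ∀ n {f : Fin n → ℕ} {c} → (∀ v → f v ≤ c) → sumFin n f ≤ n * c
sumFin-≤ zero    f≤c = z≤n
sumFin-≤ (suc n) f≤c = +-mono-≤ (f≤c zero) (sumFin-≤ n (f≤c ∘ suc))

*∣p∣≤sumFin : ∀ {n} c (p : Subset n) {f : Fin n → ℕ} → (∀ {v} → v ∈ p → c ≤ f v) → c * ∣ p ∣ ≤ sumFin n f
*∣p∣≤sumFin c []            c≤f = ≤-reflexive (*-zeroʳ c)
*∣p∣≤sumFin c (inside ∷ p)  c≤f = begin
  c * suc ∣ p ∣          ≡⟨ *-suc c ∣ p ∣ ⟩
  c + c * ∣ p ∣          ≤⟨ +-mono-≤ (c≤f here) (*∣p∣≤sumFin c p (c≤f ∘ there)) ⟩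
  _                      ∎
  where open ≤-Reasoning
*∣p∣≤sumFin c (outside ∷ p) c≤f = ≤-trans (*∣p∣≤sumFin c p (c≤f ∘ there)) (m≤n+m _ _)

sumFin-first : ∀ n r → r ≤ n → sumFin n (λ v → if toℕ v <ᵇ r then 1 else 0) ≡ r
sumFin-first n       zero    _         = trans (sumFin-const n 0) (*-zeroʳ n)
sumFin-first (suc n) (suc r) (s≤s r≤n) = cong suc (sumFin-first n r r≤n)

m<[1+m/n]*n : ∀ m n .{{_ : NonZero n}} → m < suc (m / n) * n
m<[1+m/n]*n m n = begin-strict
  m                  ≡⟨ m≡m%n+[m/n]*n m n ⟩
  m % n + m / n * n  <⟨ +-monoˡ-< (m / n * n) (m%n<n m n) ⟩
  n + m / n * n      ∎
  where open ≤-Reasoning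

m≤k*n⇒m/n≤k : ∀ {m k} n .{{_ : NonZero n}} → m ≤ k * n → m / n ≤ k
m≤k*n⇒m/n≤k {k = k} n m≤k*n = ≤-trans (/-monoˡ-≤ n m≤k*n) (≤-reflexive (m*n/n≡m k n))

-- (1 + a)(n ∸ a + m) − (1 + m) n = (a − m)(n − 1 − a)
counting-bound : ∀ {m a n} → m ≤ a → a < n → suc m * n ≤ suc a * (n ∸ a + m)
counting-bound {m} m≤a a<n with x , refl ← m≤n⇒∃[o]m+o≡n m≤a | y , refl ← m≤n⇒∃[o]m+o≡n a<n = begin
  suc m * (suc (m + x) + y)               ≤⟨ m≤m+n _ (x * y) ⟩
  suc m * (suc (m + x) + y) + x * y       ≡⟨ identity m x y ⟩
  suc (m + x) * (suc y + m)               ≡⟨ cong (λ d → suc (m + x) * (d + m)) n∸a≡1+y ⟨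
  suc (m + x) * (suc (m + x) + y ∸ (m + x) + m) ∎
  where
  open ≤-Reasoning
  identity : ∀ m x y → suc m * (suc (m + x) + y) + x * y ≡ suc (m + x) * (suc y + m)
  identity = solve-∀
  n∸a≡1+y : suc (m + x) + y ∸ (m + x) ≡ suc y
  n∸a≡1+y = trans (cong (_∸ (m + x)) (sym (+-suc (m + x) y))) (m+n∸m≡n (m + x) (suc y))

∣p∪q∣≡∣p∣+∣q∣ : ∀ {n} (p q : Subset n) → (∀ {x} → x ∈ p → x ∉ q) → ∣ p ∪ q ∣ ≡ ∣ p ∣ + ∣ q ∣
∣p∪q∣≡∣p∣+∣q∣ []            []            _    = refl
∣p∪q∣≡∣p∣+∣q∣ (inside  ∷ p) (inside  ∷ q) disj = contradiction here (disj here)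
∣p∪q∣≡∣p∣+∣q∣ (inside  ∷ p) (outside ∷ q) disj = cong suc (∣p∪q∣≡∣p∣+∣q∣ p q (λ x∈p x∈q → disj (there x∈p) (there x∈q)))
∣p∪q∣≡∣p∣+∣q∣ (outside ∷ p) (inside  ∷ q) disj =
  trans (cong suc (∣p∪q∣≡∣p∣+∣q∣ p q (λ x∈p x∈q → disj (there x∈p) (there x∈q)))) (sym (+-suc ∣ p ∣ ∣ q ∣))
∣p∪q∣≡∣p∣+∣q∣ (outside ∷ p) (outside ∷ q) disj = ∣p∪q∣≡∣p∣+∣q∣ p q (λ x∈p x∈q → disj (there x∈p) (there x∈q))

p≡⊤⊎∃∉p : ∀ {n} (p : Subset n) → p ≡ ⊤ ⊎ ∃[ x ] x ∉ p
p≡⊤⊎∃∉p p with any? (λ x → ¬? (x ∈? p))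
... | yes ∃x∉p = inj₂ ∃x∉p
... | no  ∄x∉p = inj₁ (⊆-antisym ⊆⊤ (λ {x} _ → decidable-stable (x ∈? p) (λ x∉p → ∄x∉p (x , x∉p))))

x∉p⇒∣p∣<n : ∀ {n x} {p : Subset n} → x ∉ p → ∣ p ∣ < n
x∉p⇒∣p∣<n {n} {p = p} x∉p = subst (∣ p ∣ <_) (∣⊤∣≡n n) (p⊂q⇒∣p∣<∣q∣ (⊆⊤ , _ , ∈⊤ , x∉p))

argmax-∈ : ∀ {n} (f : Fin n → ℕ) (p : Subset n) → Nonempty p →
           ∃[ u ] u ∈ p × (∀ {v} → v ∈ p → f v ≤ f u)
argmax-∈ f (outside ∷ p) (suc x , there x∈p) with u , u∈p , max ← argmax-∈ (f ∘ suc) p (x , x∈p) =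
  suc u , there u∈p , λ { (there v∈p) → max v∈p }
argmax-∈ f (inside ∷ p) _ with nonempty? p
... | no  p-empty = zero , here , λ { here → ≤-refl ; (there v∈p) → contradiction (_ , v∈p) p-empty }
... | yes p-nonempty with u , u∈p , max ← argmax-∈ (f ∘ suc) p p-nonempty | f (suc u) ≤? f zero
...   | yes fu≤f0 = zero , here , λ { here → ≤-refl ; (there v∈p) → ≤-trans (max v∈p) fu≤f0 }
...   | no  fu≰f0 = suc u , there u∈p , λ { here → <⇒≤ (≰⇒> fu≰f0) ; (there v∈p) → max v∈p }

∣p∣<n⇒∃∉p : ∀ {n} {p : Subset n} → ∣ p ∣ < n → ∃[ x ] x ∉ p
∣p∣<n⇒∃∉p {n} {p} ∣p∣<n with p≡⊤⊎∃∉p p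
... | inj₁ refl  = contradiction (∣⊤∣≡n n) (<⇒≢ ∣p∣<n)
... | inj₂ ∃x∉p = ∃x∉p

Heaviest : ∀ {n} → (Fin n → ℕ) → Subset n → Set
Heaviest τ M = ∀ {u v} → v ∈ M → u ∉ M → τ u ≤ τ v

x∉p⇒∣p∪⁅x⁆∣≡1+∣p∣ : ∀ {n x} {p : Subset n} → x ∉ p → ∣ p ∪ ⁅ x ⁆ ∣ ≡ suc ∣ p ∣
x∉p⇒∣p∪⁅x⁆∣≡1+∣p∣ {x = x} {p} x∉p = begin
  ∣ p ∪ ⁅ x ⁆ ∣       ≡⟨ ∣p∪q∣≡∣p∣+∣q∣ p ⁅ x ⁆ (λ y∈p y∈x → x∉p (subst (_∈ p) (x∈⁅y⁆⇒x≡y x y∈x) y∈p)) ⟩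
  ∣ p ∣ + ∣ ⁅ x ⁆ ∣   ≡⟨ cong (∣ p ∣ +_) (∣⁅x⁆∣≡1 x) ⟩
  ∣ p ∣ + 1           ≡⟨ +-comm ∣ p ∣ 1 ⟩
  suc ∣ p ∣           ∎
  where open ≡-Reasoning

heaviest-∪ : ∀ {n} {τ : Fin n → ℕ} {M w} → Heaviest τ M → (∀ {u} → u ∉ M → τ u ≤ τ w) →
             Heaviest τ (M ∪ ⁅ w ⁆)
heaviest-∪ {M = M} {w} heaviest maximal {u} v∈M′ u∉M′ with x∈p∪q⁻ M ⁅ w ⁆ v∈M′
... | inj₁ v∈M = heaviest v∈M (u∉M′ ∘ x∈p∪q⁺ ∘ inj₁)
... | inj₂ v∈w rewrite x∈⁅y⁆⇒x≡y w v∈w = maximal (u∉M′ ∘ x∈p∪q⁺ ∘ inj₁)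

∃-heaviest : ∀ {n} (τ : Fin n → ℕ) {m} → m ≤ n → ∃[ M ] ∣ M ∣ ≡ m × Heaviest τ M
∃-heaviest {n} τ {zero}  _   = ⊥ , ∣⊥∣≡0 n , λ v∈⊥ → contradiction v∈⊥ ∉⊥
∃-heaviest     τ {suc m} m<n
  with M , refl , heaviest ← ∃-heaviest τ (<⇒≤ m<n)
  with x , x∉M ← ∣p∣<n⇒∃∉p m<n
  with w , w∈∁M , maximal ← argmax-∈ τ (∁ M) (x , x∉p⇒x∈∁p x∉M)
  = M ∪ ⁅ w ⁆ , x∉p⇒∣p∪⁅x⁆∣≡1+∣p∣ (x∈∁p⇒x∉p w∈∁M) , heaviest-∪ heaviest (maximal ∘ x∉p⇒x∈∁p)

-- The dynamic process on an arbitrary graph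

module _ {n} (G : Graph n) (τ : Fin n → ℕ) where

  Stuck : Subset n → Set
  Stuck A = ∀ {v} → v ∉ A → ∣ A ∩ N G v ∣ < τ v

  private
    lookup-step : ∀ A v → lookup (step G τ A) v ≡ (lookup A v ∨ isYes (τ v ≤? ∣ A ∩ N G v ∣))
    lookup-step A v = lookup∘tabulate _ v

  ∈-step⁺ : ∀ {A v} → v ∈ A ⊎ τ v ≤ ∣ A ∩ N G v ∣ → v ∈ step G τ A
  ∈-step⁺ {A} {v} h = lookup⇒[]= v _ (trans (lookup-step A v)
    (T-≡ .to (T-∨ .from (Sum.map (T-≡ .from ∘ []=⇒lookup) fromWitness h))))

  ∈-step⁻ : ∀ {A v} → v ∈ step G τ A → v ∈ A ⊎ τ v ≤ ∣ A ∩ N G v ∣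
  ∈-step⁻ {A} {v} v∈ = Sum.map (lookup⇒[]= v A ∘ T-≡ .to) toWitness
    (T-∨ .to (T-≡ .from (trans (sym (lookup-step A v)) ([]=⇒lookup v∈))))

  ⊆-step : ∀ {A} → A ⊆ step G τ A
  ⊆-step = ∈-step⁺ ∘ inj₁

  step-stuck : ∀ {A} → Stuck A → step G τ A ≡ A
  step-stuck {A} stuck = ⊆-antisym step⊆A ⊆-step
    where
    step⊆A : step G τ A ⊆ A
    step⊆A {v} v∈ with ∈-step⁻ v∈
    ... | inj₁ v∈A = v∈A
    ... | inj₂ τv≤ = decidable-stable (v ∈? A) (λ v∉A → <⇒≱ (stuck v∉A) τv≤)

  ⊂-step : ∀ {A} → ¬ Stuck A → A ⊂ step G τ A
  ⊂-step {A} unstuck with any? (λ v → ¬? (v ∈? A) ×-dec (τ v ≤? ∣ A ∩ N G v ∣))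
  ... | yes (v , v∉A , τv≤) = ⊆-step , v , ∈-step⁺ {A} (inj₂ τv≤) , v∉A
  ... | no  none            = contradiction (λ {v} v∉A → ≰⇒> (λ τv≤ → none (v , v∉A , τv≤))) unstuck

  step-⊤ : step G τ ⊤ ≡ ⊤
  step-⊤ = ⊆-antisym ⊆⊤ ⊆-step

  ⊆-active : ∀ {M} i → M ⊆ active G τ M i
  ⊆-active zero    = id
  ⊆-active (suc i) = ⊆-step ∘ ⊆-active i

  active-stuck : ∀ {M} → Stuck M → ∀ i → active G τ M i ≡ M
  active-stuck stuck zero    = refl
  active-stuck stuck (suc i) = trans (cong (step G τ) (active-stuck stuck i)) (step-stuck stuck)

  stuck-monopoly⇒⊤ : ∀ {M} → Stuck M → IsDynMonopoly G τ M → M ≡ ⊤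
  stuck-monopoly⇒⊤ stuck (i , full) = trans (sym (active-stuck stuck i)) full

  -- Each round before saturation adds a vertex, so n + 1 rounds suffice.
  monopoly-if-unstuck : ∀ {M} → (∀ {A u} → M ⊆ A → u ∉ A → ¬ Stuck A) → IsDynMonopoly G τ M
  monopoly-if-unstuck {M} grows = suc n , Sum.[ too-large , id ] (progress (suc n))
    where
    too-large : suc n ≤ ∣ active G τ M (suc n) ∣ → active G τ M (suc n) ≡ ⊤
    too-large n<∣A∣ = contradiction (∣p∣≤n (active G τ M (suc n))) (<⇒≱ n<∣A∣)
    progress : ∀ i → i ≤ ∣ active G τ M i ∣ ⊎ active G τ M i ≡ ⊤
    progress zero = inj₁ z≤n
    progress (suc i) with p≡⊤⊎∃∉p (active G τ M i) | progress i
    ... | inj₁ full      | _         = inj₂ (trans (cong (step G τ) full) step-⊤)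
    ... | inj₂ (u , u∉A) | inj₁ i≤   = inj₁ (≤-<-trans i≤ (p⊂q⇒∣p∣<∣q∣ (⊂-step (grows (⊆-active i) u∉A))))
    ... | inj₂ (u , u∉A) | inj₂ full = contradiction (subst (u ∈_) (sym full) ∈⊤) u∉A

  ≤∣monopoly∣ : ∀ {q M} → q ≤ n → (∀ v → q ≤ τ v) → IsDynMonopoly G τ M → q ≤ ∣ M ∣
  ≤∣monopoly∣ {q} {M} q≤n q≤τ monopoly = ≮⇒≥ small-impossible
    where
    small-impossible : ¬ ∣ M ∣ < q
    small-impossible ∣M∣<q = <⇒≱ ∣M∣<q (subst (q ≤_) (sym ∣M∣≡n) q≤n)
      where
      stuck : Stuck M
      stuck {v} _ = <-≤-trans (≤-<-trans (∣p∩q∣≤∣p∣ M (N G v)) ∣M∣<q) (q≤τ v)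
      ∣M∣≡n : ∣ M ∣ ≡ n
      ∣M∣≡n = trans (cong ∣_∣ (stuck-monopoly⇒⊤ stuck monopoly)) (∣⊤∣≡n n)

-- Complete graphs

N-irrefl : ∀ {n} (G : Graph n) v → v ∉ N G v
N-irrefl G v v∈N with () ← trans (sym ([]=⇒lookup v∈N)) (trans (lookup∘tabulate (adj G v) v) (irrefl G v))

N-K : ∀ {n} (v : Fin n) → N (K n) v ≡ ∁ ⁅ v ⁆
N-K {n} v = ⊆-antisym N⊆∁⁅v⁆ ∁⁅v⁆⊆N
  where
  N⊆∁⁅v⁆ : N (K n) v ⊆ ∁ ⁅ v ⁆
  N⊆∁⁅v⁆ u∈N = x∉p⇒x∈∁p (x≢y⇒x∉⁅y⁆ λ { refl → N-irrefl (K n) v u∈N })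
  ∁⁅v⁆⊆N : ∁ ⁅ v ⁆ ⊆ N (K n) v
  ∁⁅v⁆⊆N {u} u∈∁⁅v⁆ = lookup⇒[]= u _ (trans (lookup∘tabulate _ u)
    (T-≡ .to (fromWitnessFalse {a? = v ≟ u} (x∉⁅y⁆⇒x≢y (x∈∁p⇒x∉p u∈∁⁅v⁆) ∘ sym))))

deg-K : ∀ {k} (v : Fin (suc k)) → deg (K (suc k)) v ≡ k
deg-K {k} v = begin
  ∣ N (K (suc k)) v ∣    ≡⟨ cong ∣_∣ (N-K v) ⟩
  ∣ ∁ ⁅ v ⁆ ∣            ≡⟨ ∣∁p∣≡n∸∣p∣ ⁅ v ⁆ ⟩
  suc k ∸ ∣ ⁅ v ⁆ ∣      ≡⟨ cong (suc k ∸_) (∣⁅x⁆∣≡1 v) ⟩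
  k                      ∎
  where open ≡-Reasoning

sumFin-threshold-K : ∀ {k τ} → IsThreshold (K (suc k)) τ → sumFin (suc k) τ ≤ k * suc k
sumFin-threshold-K {k} {τ} threshold =
  subst (sumFin (suc k) τ ≤_) (*-comm (suc k) k) (sumFin-≤ (suc k) (λ v → subst (τ v ≤_) (deg-K v) (threshold v)))

stuck-K : ∀ {n τ A v} → Stuck (K n) τ A → v ∉ A → ∣ A ∣ < τ v
stuck-K {n} {A = A} {v} stuck v∉A = ≤-<-trans (p⊆q⇒∣p∣≤∣q∣ A⊆A∩N) (stuck v∉A)
  where
  A⊆A∩N : A ⊆ A ∩ N (K n) v
  A⊆A∩N {x} x∈A = x∈p∩q⁺ (x∈A , subst (x ∈_) (sym (N-K v)) (x∉p⇒x∈∁p (x≢y⇒x∉⁅y⁆ λ { refl → v∉A x∈A })))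

heaviest-monopoly-K : ∀ {n τ M} → Heaviest τ M → sumFin n τ < suc ∣ M ∣ * n → IsDynMonopoly (K n) τ M
heaviest-monopoly-K {n} {τ} {M} heaviest ∑τ< =
  monopoly-if-unstuck (K n) τ λ M⊆A u∉A stuck → <⇒≱ ∑τ< (stuck-sum M⊆A u∉A stuck)
  where
  stuck-sum : ∀ {A u} → M ⊆ A → u ∉ A → Stuck (K n) τ A → suc ∣ M ∣ * n ≤ sumFin n τ
  stuck-sum {A} {u} M⊆A u∉A stuck = begin
    suc ∣ M ∣ * n                     ≤⟨ counting-bound (p⊆q⇒∣p∣≤∣q∣ M⊆A) (x∉p⇒∣p∣<n u∉A) ⟩
    suc ∣ A ∣ * (n ∸ ∣ A ∣ + ∣ M ∣)   ≡⟨ cong (suc ∣ A ∣ *_) ∣∁A∪M∣ ⟨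
    suc ∣ A ∣ * ∣ ∁ A ∪ M ∣           ≤⟨ *∣p∣≤sumFin (suc ∣ A ∣) (∁ A ∪ M) heavy ⟩
    sumFin n τ                        ∎
    where
    open ≤-Reasoning
    ∣∁A∪M∣ : ∣ ∁ A ∪ M ∣ ≡ n ∸ ∣ A ∣ + ∣ M ∣
    ∣∁A∪M∣ = trans (∣p∪q∣≡∣p∣+∣q∣ (∁ A) M (λ x∈∁A x∈M → x∈∁p⇒x∉p x∈∁A (M⊆A x∈M)))
                   (cong (_+ ∣ M ∣) (∣∁p∣≡n∸∣p∣ A))
    heavy : ∀ {v} → v ∈ ∁ A ∪ M → suc ∣ A ∣ ≤ τ v
    heavy v∈ with x∈p∪q⁻ (∁ A) M v∈
    ... | inj₁ v∈∁A = stuck-K stuck (x∈∁p⇒x∉p v∈∁A)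
    ... | inj₂ v∈M  = <-≤-trans (stuck-K stuck u∉A) (heaviest v∈M (u∉A ∘ M⊆A))

∃-monopoly-K : ∀ {n} τ {m} → m ≤ n → sumFin n τ < suc m * n →
                   ∃[ M ] IsDynMonopoly (K n) τ M × ∣ M ∣ ≡ m
∃-monopoly-K τ m≤n ∑τ< with M , refl , heaviest ← ∃-heaviest τ m≤n =
  M , heaviest-monopoly-K heaviest ∑τ< , refl

dyn-K≤ : ∀ {k τ m} → IsThreshold (K (suc k)) τ → IsDyn (K (suc k)) τ m → m ≤ sumFin (suc k) τ / suc k
dyn-K≤ {k} {τ} threshold (_ , minimal)
  with M , monopoly , ∣M∣≡ ←
         ∃-monopoly-K τ (m≤n⇒m≤1+n (m≤k*n⇒m/n≤k (suc k) (sumFin-threshold-K threshold)))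
                        (m<[1+m/n]*n (sumFin (suc k) τ) (suc k))
  = ≤-trans (minimal M monopoly) (≤-reflexive ∣M∣≡)

-- An extremal assignment

spread : ∀ {n} → ℕ → ℕ → Fin n → ℕ
spread q r v = q + (if toℕ v <ᵇ r then 1 else 0)

sumFin-spread : ∀ n q r → r ≤ n → sumFin n (spread q r) ≡ r + q * n
sumFin-spread n q r r≤n = begin
  sumFin n (spread q r)                                      ≡⟨ sumFin-+ n (λ _ → q) _ ⟩
  sumFin n (λ _ → q) + sumFin n (λ v → if toℕ v <ᵇ r then 1 else 0)
    ≡⟨ cong₂ _+_ (sumFin-const n q) (sumFin-first n r r≤n) ⟩
  n * q + r                                                  ≡⟨ +-comm (n * q) r ⟩
  r + n * q                                                  ≡⟨ cong (r +_) (*-comm n q) ⟩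
  r + q * n                                                  ∎
  where open ≡-Reasoning

spread-≤ : ∀ {n k q r} .{{_ : NonZero n}} → r + q * n ≤ k * n → (v : Fin n) → spread q r v ≤ k
spread-≤ {n} {k} {q} {zero}  r+qn≤kn v = ≤-trans (≤-reflexive (+-identityʳ q)) (*-cancelʳ-≤ q k n r+qn≤kn)
spread-≤ {n} {k} {q} {suc r} r+qn≤kn v = begin
  q + (if toℕ v <ᵇ suc r then 1 else 0)  ≤⟨ +-monoʳ-≤ q (bit≤1 (toℕ v <ᵇ suc r)) ⟩
  q + 1                                  ≡⟨ +-comm q 1 ⟩
  suc q                                  ≤⟨ *-cancelʳ-< n q k (<-≤-trans (m<n+m (q * n) z<s) r+qn≤kn) ⟩
  k                                      ∎
  where
  open ≤-Reasoning
  bit≤1 : ∀ b → (if b then 1 else 0) ≤ 1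
  bit≤1 true  = ≤-refl
  bit≤1 false = z≤n

module Spread (k S : ℕ) where
  private
    n : ℕ
    n = suc k

  q : ℕ
  q = S / n

  τ₀ : Fin n → ℕ
  τ₀ = spread q (S % n)

  sumFin-τ₀ : sumFin n τ₀ ≡ S
  sumFin-τ₀ = trans (sumFin-spread n q (S % n) (<⇒≤ (m%n<n S n))) (sym (m≡m%n+[m/n]*n S n))

  module _ (S≤kn : S ≤ k * n) where
    threshold-τ₀ : IsThreshold (K n) τ₀
    threshold-τ₀ v = subst (τ₀ v ≤_) (sym (deg-K v)) (spread-≤ {q = q} {S % n} (subst (_≤ k * n) (m≡m%n+[m/n]*n S n) S≤kn) v)

    dyn-τ₀ : IsDyn (K n) τ₀ q
    dyn-τ₀ = ∃-monopoly-K τ₀ q≤n (subst (_< suc q * n) (sym sumFin-τ₀) (m<[1+m/n]*n S n))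
           , λ M → ≤∣monopoly∣ (K n) τ₀ q≤n (λ v → m≤m+n q _)
      where
      q≤n : q ≤ n
      q≤n = m≤n⇒m≤1+n (m≤k*n⇒m/n≤k n S≤kn)

-- Floors of averages

-- Imported only here: its prefix +_ would make ∣ p ∣ + ∣ q ∣ and sections (c +_) ambiguous.
open import Data.Integer using (+_)

floor-common-factor : ∀ (p : ℚ) S n g .{{_ : NonZero n}} →
                      ↥ p ℤ.* + g ≡ + S → ↧ p ℤ.* + g ≡ + n → floor p ≡ + (S / n)
floor-common-factor (mkℚ -[1+ _ ] _ _) S n (suc g) () _
floor-common-factor (mkℚ _ d _) S (suc n) zero _ d*0≡n
  with () ← trans (sym (ℤ.*-zeroʳ (+ suc d))) d*0≡n
floor-common-factor (mkℚ (+ a) d _) S n (suc g) a*g≡S d*g≡n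
  with refl ← ℤ.+-injective (trans (ℤ.pos-* a (suc g)) a*g≡S)
     | refl ← ℤ.+-injective (trans (ℤ.pos-* (suc d) (suc g)) d*g≡n) = begin
  + a ℤ./ + suc d                      ≡⟨ div-pos-is-/ℕ (+ a) (suc d) ⟩
  + (a / suc d)                        ≡⟨ cong +_ (m*n/o*n≡m/o a (suc g) (suc d)) ⟨
  + (a * suc g / (suc d * suc g))      ∎
  where open ≡-Reasoning

floor-/ : ∀ S n .{{_ : NonZero n}} → floor (+ S ℚ./ n) ≡ + (S / n)
floor-/ S n = floor-common-factor (+ S ℚ./ n) S n _ (↥-/ (+ S) n) (↧-/ (+ S) n)

floor-avg : ∀ S n .{{_ : NonZero n}} {t} → + S ℚ./ n ≡ t → floor t ≡ + (S / n)
floor-avg S n refl = floor-/ S n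

proposition4 : (k : ℕ) (t : ℚ) → (∃[ τ ] HasAvg (K (suc k)) τ t) →
    ∃[ d ] (IsDynAvg (K (suc k)) t d × + d ≡ floor t)
proposition4 k t (τ , threshold , mean) = q , (attained , bounded) , sym (floor-avg S n mean)
  where
  n S : ℕ
  n = suc k
  S = sumFin n τ
  open Spread k S
  attained : ∃[ τ′ ] (HasAvg (K n) τ′ t × IsDyn (K n) τ′ q)
  attained = τ₀ , (threshold-τ₀ S≤kn , trans (cong (λ s → + s ℚ./ n) sumFin-τ₀) mean) , dyn-τ₀ S≤kn
    where
    S≤kn : S ≤ k * n
    S≤kn = sumFin-threshold-K threshold
  bounded : ∀ τ′ m → HasAvg (K n) τ′ t → IsDyn (K n) τ′ m → m ≤ q
  bounded τ′ m (threshold′ , mean′) dyn′ = begin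
    m                ≤⟨ dyn-K≤ threshold′ dyn′ ⟩
    sumFin n τ′ / n  ≡⟨ ℤ.+-injective (trans (sym (floor-avg (sumFin n τ′) n mean′)) (floor-avg S n mean)) ⟩
    q                ∎
    where open ≤-Reasoning
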